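{- The structural $\lambda$-calculus $\lambda j$ enjoys PSN: for every pure $\lambda$-term $t$, if $t$ is $\beta$-strongly normalising then $t$ is $\lambda j$-strongly normalising.
   Context: Terms of $\lambda j$ are generated by $t,u ::= x \mid \lambda x.t \mid t\,u \mid t[x/u]$; $[x/u]$ is a jump, and $\lambda x.t$ and $t[x/u]$ bind $x$ in $t$ (not in $u$). Terms are taken modulo $\alpha$-conversion. $\mathrm{fv}(t)$ is the set of free variables, $|t|_x$ the number of free occurrences of $x$ in $t$, $t\{x/u\}$ is capture-avoiding meta-level substitution. Pure $\lambda$-terms are the terms without jumps, with $\beta$-reduction $(\lambda x.t)u\to_\beta t\{x/u\}$ closed under contexts. When $|t|_x\ge2$, $t_{[y]_x}$ denotes any term obtained from $t$ by renaming $i$ free occurrences of $x$ into a fresh variable $y$, $1\le i\le|t|_x-1$. The rules of $\lambda j$ are: (dB) $(\lambda x.t)L\,u\mapsto t[x/u]L$ with $L=[x_1/u_1]\dots[x_k/u_k]$ a possibly empty list of jumps such that $\{x_1,\dots,x_k\}\cap\mathrm{fv}(u)=\emptyset$; (w) $t[x/u]\mapsto t$ if $|t|_x=0$; (d) $t[x/u]\mapsto t\{x/u\}$ if $|t|_x=1$; (c) $t[x/u]\mapsto t_{[y]_x}[x/u][y/u]$ if $|t|_x>1$, $y$ fresh. $\to_{\lambda j}$ is the contextual closure of these rules. A term is strongly normalising for a relation if there is no infinite reduction sequence from it. -}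

module Defs where

-- The structural λ-calculus λj, with terms modulo α-conversion represented
-- by well-scoped de Bruijn terms: Tm n = terms with free variables among Fin n.

open import Data.Nat using (ℕ; zero; suc; _+_; _>_; _≥_)
open import Data.Fin using (Fin; zero; suc)
open import Relation.Binary.PropositionalEquality using (_≡_)
open import Induction.WellFounded using (Acc)

data Tm (n : ℕ) : Set where
  var : Fin n → Tm n
  lam : Tm (suc n) → Tm n
  app : Tm n → Tm n → Tm n
  jmp : Tm (suc n) → Tm n → Tm n      -- jmp t u  =  t[x/u]

data Pure {n : ℕ} : Tm n → Set where
  var : (x : Fin n) → Pure (var x)
  lam : {t : Tm (suc n)} → Pure t → Pure (lam t)
  app : {t u : Tm n} → Pure t → Pure u → Pure (app t u)

lift : {n m : ℕ} → (Fin n → Fin m) → Fin (suc n) → Fin (suc m)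
lift ρ zero    = zero
lift ρ (suc x) = suc (ρ x)

ren : {n m : ℕ} → (Fin n → Fin m) → Tm n → Tm m
ren ρ (var x)   = var (ρ x)
ren ρ (lam t)   = lam (ren (lift ρ) t)
ren ρ (app t u) = app (ren ρ t) (ren ρ u)
ren ρ (jmp t u) = jmp (ren (lift ρ) t) (ren ρ u)

liftS : {n m : ℕ} → (Fin n → Tm m) → Fin (suc n) → Tm (suc m)
liftS σ zero    = var zero
liftS σ (suc x) = ren suc (σ x)

subst : {n m : ℕ} → (Fin n → Tm m) → Tm n → Tm m
subst σ (var x)   = σ x
subst σ (lam t)   = lam (subst (liftS σ) t)
subst σ (app t u) = app (subst σ t) (subst σ u)
subst σ (jmp t u) = jmp (subst (liftS σ) t) (subst σ u)

sub0 : {n : ℕ} → Tm n → Fin (suc n) → Tm n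
sub0 u zero    = u
sub0 u (suc x) = var x

_⟨0≔_⟩ : {n : ℕ} → Tm (suc n) → Tm n → Tm n
t ⟨0≔ u ⟩ = subst (sub0 u) t

eqFin : {n : ℕ} → Fin n → Fin n → ℕ
eqFin zero    zero    = 1
eqFin zero    (suc y) = 0
eqFin (suc x) zero    = 0
eqFin (suc x) (suc y) = eqFin x y

occ : {n : ℕ} → Tm n → Fin n → ℕ
occ (var y)   x = eqFin x y
occ (lam t)   x = occ t (suc x)
occ (app t u) x = occ t x + occ u x
occ (jmp t u) x = occ t (suc x) + occ u x

-- lists of jumps L = [x₁/u₁]…[x_k/u_k], as a context around a term.
-- Jumps n m : the plugged term lives in scope m, the result in scope n.
-- The first element is the outermost jump [x_k/u_k].
data Jumps (n : ℕ) : ℕ → Set where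
  []  : Jumps n n
  _∷_ : {m : ℕ} → Tm n → Jumps (suc n) m → Jumps n m

plug : {n m : ℕ} → Jumps n m → Tm m → Tm n
plug []      t = t
plug (u ∷ L) t = jmp (plug L t) u

-- the weakening of scope n into scope m induced by the variables bound by L
-- (this encodes the side condition {x₁,…,x_k} ∩ fv(u) = ∅ of dB)
wkJ : {n m : ℕ} → Jumps n m → Fin n → Fin m
wkJ []      x = x
wkJ (u ∷ L) x = wkJ L (suc x)

-- For rule (c) the term t_{[y]_x} lives in scope n+2 with x = zero,
-- y = suc zero; merging y back into x (renaming y to x) gives t.
merge : {n : ℕ} → Fin (suc (suc n)) → Fin (suc n)
merge zero          = zero
merge (suc zero)    = zero
merge (suc (suc z)) = suc z

data _↦j_ {n : ℕ} : Tm n → Tm n → Set where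
  dB : {m : ℕ} (L : Jumps n m) (t : Tm (suc m)) (u : Tm n) →
       app (plug L (lam t)) u ↦j plug L (jmp t (ren (wkJ L) u))
  w  : (t : Tm (suc n)) (t' : Tm n) (u : Tm n) →
       occ t zero ≡ 0 → t ≡ ren suc t' →
       jmp t u ↦j t'
  d  : (t : Tm (suc n)) (u : Tm n) →
       occ t zero ≡ 1 →
       jmp t u ↦j (t ⟨0≔ u ⟩)
  c  : (t : Tm (suc n)) (t' : Tm (suc (suc n))) (u : Tm n) →
       occ t zero > 1 →
       ren merge t' ≡ t → occ t' zero ≥ 1 → occ t' (suc zero) ≥ 1 →
       -- t' = t_{[y]_x} with x = zero, y = suc zero;  result t_{[y]_x}[x/u][y/u]
       jmp t u ↦j jmp (jmp t' (ren suc u)) u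

data Ctx (R : {n : ℕ} → Tm n → Tm n → Set) {n : ℕ} : Tm n → Tm n → Set where
  root : {t t' : Tm n} → R t t' → Ctx R t t'
  lam  : {t t' : Tm (suc n)} → Ctx R t t' → Ctx R (lam t) (lam t')
  appl : {t t' u : Tm n} → Ctx R t t' → Ctx R (app t u) (app t' u)
  appr : {t u u' : Tm n} → Ctx R u u' → Ctx R (app t u) (app t u')
  jmpl : {t t' : Tm (suc n)} {u : Tm n} → Ctx R t t' → Ctx R (jmp t u) (jmp t' u)
  jmpr : {t : Tm (suc n)} {u u' : Tm n} → Ctx R u u' → Ctx R (jmp t u) (jmp t u')

_→λj_ : {n : ℕ} → Tm n → Tm n → Set
_→λj_ = Ctx _↦j_

data _↦β_ {n : ℕ} : Tm n → Tm n → Set where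
  beta : (t : Tm (suc n)) (u : Tm n) → app (lam t) u ↦β (t ⟨0≔ u ⟩)

_→β_ : {n : ℕ} → Tm n → Tm n → Set
_→β_ = Ctx _↦β_

SN : {n : ℕ} → (Tm n → Tm n → Set) → Tm n → Set
SN R t = Acc (λ t' t → R t t') t

-- Typability in a system of non-idempotent intersection types (multisets represented
-- as lists up to permutation) is sandwiched between the two notions of normalisation.
-- Soundness: every λj step strictly decreases the size of a derivation.  Arguments of
-- applications and jumps are typed at least once, so steps inside them are counted;
-- application and jump nodes are weighted by the square of the cardinality of their
-- multiset, so dB (application to jump) costs 1, w and d remove a jump node and at
-- most re-use its argument derivations, and c, which splits a multiset of
-- cardinality i + j over two jumps, pays i² + j² < (i + j)².
-- Completeness: by well-founded induction on β-reduction and subterms, a β-SN pure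
-- term is neutral, an abstraction or a head redex C[(λx.s)u]; the latter is typed by
-- subject expansion from C[s{x/u}] together with a typing of its β-SN subterm u.

module Submission where

open import Defs
open import Algebra.Bundles using (CommutativeMonoid)
import Algebra.Properties.CommutativeSemigroup
open import Data.Bool using (Bool; true; false; if_then_else_)
open import Data.Fin using (Fin; zero; suc)
open import Data.List using (List; []; _∷_; [_]; _++_; length)
open import Data.List.Properties using (length-++)
open import Data.List.Relation.Binary.Permutation.Propositional
  using (_↭_; ↭-refl; ↭-sym; ↭-trans; ↭-reflexive; prep; swap) renaming (refl to ↭-prefl; trans to ↭-ptrans)
open import Data.List.Relation.Binary.Permutation.Propositional.Properties
  using (++⁺; ++⁺ˡ; ++⁺ʳ; ++-comm; ++-assoc; ++-identityʳ; ↭-length; shifts; ++-commutativeMonoid)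
open import Data.Nat using (ℕ; zero; suc; _+_; _*_; _≤_; _<_; _≥_; z≤n; s≤s)
open import Data.Nat.Induction using (<-wellFounded)
open import Data.Nat.Properties
open import Data.Nat.Tactic.RingSolver using (solve-∀)
open import Data.Product using (Σ; Σ-syntax; ∃; _×_; _,_; proj₁; proj₂)
open import Function using (_∘_; id)
open import Induction.WellFounded using (Acc; acc)
open import Relation.Binary.Construct.Closure.Transitive using (TransClosure; _∷ʳ_; accessible) renaming ([_] to [_]⁺)
open import Relation.Binary.PropositionalEquality
  using (_≡_; refl; sym; trans; cong; cong₂) renaming (subst to transport)

module ++-Props {A : Set} =
  Algebra.Properties.CommutativeSemigroup (CommutativeMonoid.commutativeSemigroup (++-commutativeMonoid {A = A}))
module +-Props = Algebra.Properties.CommutativeSemigroup +-commutativeSemigroup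

private variable
  n m : ℕ
  A : Set

_==_ : Fin n → Fin n → Bool
zero  == zero  = true
zero  == suc y = false
suc x == zero  = false
suc x == suc y = x == y

==-refl : (x : Fin n) → (x == x) ≡ true
==-refl zero    = refl
==-refl (suc x) = ==-refl x

==-sound : (x y : Fin n) → (x == y) ≡ true → x ≡ y
==-sound zero    zero    _ = refl
==-sound (suc x) (suc y) e = cong suc (==-sound x y e)

==-sym : (x y : Fin n) → (x == y) ≡ (y == x)
==-sym zero    zero    = refl
==-sym zero    (suc y) = refl
==-sym (suc x) zero    = refl
==-sym (suc x) (suc y) = ==-sym x y

concatF : (Fin n → List A) → List A
concatF {n = zero}  f = []
concatF {n = suc n} f = f zero ++ concatF (f ∘ suc)

sumF : (Fin n → ℕ) → ℕ
sumF {n = zero}  f = 0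
sumF {n = suc n} f = f zero + sumF (f ∘ suc)

module _ {A : Set} where
  concatF-cong : {f g : Fin n → List A} → (∀ x → f x ↭ g x) → concatF f ↭ concatF g
  concatF-cong {n = zero}  h = ↭-refl
  concatF-cong {n = suc n} h = ++⁺ (h zero) (concatF-cong (h ∘ suc))

  concatF-[] : {f : Fin n → List A} → (∀ x → f x ≡ []) → concatF f ≡ []
  concatF-[] {n = zero}  h = refl
  concatF-[] {n = suc n} h rewrite h zero = concatF-[] (h ∘ suc)

  concatF-++ : (f g : Fin n → List A) → concatF (λ x → f x ++ g x) ↭ concatF f ++ concatF g
  concatF-++ {n = zero}  f g = ↭-refl
  concatF-++ {n = suc n} f g =
    ↭-trans (++⁺ˡ (f zero ++ g zero) (concatF-++ (f ∘ suc) (g ∘ suc))) (++-Props.interchange (f zero) (g zero) _ _)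

  concatF-only : (x : Fin n) (f : Fin n → List A) → (∀ x' → (x == x') ≡ false → f x' ≡ []) →
                 concatF f ↭ f x
  concatF-only {n = suc n} zero f h
    rewrite concatF-[] {f = f ∘ suc} (λ x' → h (suc x') refl) = ++-identityʳ (f zero)
  concatF-only {n = suc n} (suc x) f h rewrite h zero refl = concatF-only x (f ∘ suc) (h ∘ suc)

  concatF-select : (y : Fin n) (f : Fin n → List A) → concatF (λ x → if x == y then f x else []) ↭ f y
  concatF-select y f = ↭-trans (concatF-only y _ off) (↭-reflexive (cong (λ b → if b then f y else []) (==-refl y)))
    where
    off : ∀ x → (y == x) ≡ false → (if x == y then f x else []) ≡ []
    off x e rewrite ==-sym x y | e = refl

sumF-cong : {f g : Fin n → ℕ} → (∀ x → f x ≡ g x) → sumF f ≡ sumF g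
sumF-cong {n = zero}  h = refl
sumF-cong {n = suc n} h = cong₂ _+_ (h zero) (sumF-cong (h ∘ suc))

sumF-+ : (f g : Fin n → ℕ) → sumF (λ x → f x + g x) ≡ sumF f + sumF g
sumF-+ {n = zero}  f g = refl
sumF-+ {n = suc n} f g rewrite sumF-+ (f ∘ suc) (g ∘ suc) = +-Props.interchange (f zero) (g zero) _ _

sumF-0 : {f : Fin n → ℕ} → (∀ x → f x ≡ 0) → sumF f ≡ 0
sumF-0 {n = zero}  h = refl
sumF-0 {n = suc n} h rewrite h zero = sumF-0 (h ∘ suc)

sumF-only : (x : Fin n) (f : Fin n → ℕ) → (∀ x' → (x == x') ≡ false → f x' ≡ 0) → sumF f ≡ f x
sumF-only {n = suc n} zero f h = trans (cong (f zero +_) (sumF-0 (λ x' → h (suc x') refl))) (+-identityʳ _)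
sumF-only {n = suc n} (suc x) f h rewrite h zero refl = sumF-only x (f ∘ suc) (h ∘ suc)

+-balance : (a b x y a' b' x' y' : ℕ) → a + x ≡ b + y → a' + x' ≡ b' + y' →
            (a + a') + (x + x') ≡ (b + b') + (y + y')
+-balance a b x y a' b' x' y' p q =
  trans (+-Props.interchange a a' x x') (trans (cong₂ _+_ p q) (+-Props.interchange b y b' y'))

+-balance-node : (k a b x y a' b' x' y' : ℕ) → a + x ≡ b + y → a' + x' ≡ b' + y' →
                 (a + a' + k) + (x + x') ≡ (b + b' + k) + (y + y')
+-balance-node k a b x y a' b' x' y' p q =
  trans (+-Props.xy∙z≈xz∙y (a + a') k (x + x'))
        (trans (cong (_+ k) (+-balance a b x y a' b' x' y' p q)) (+-Props.xy∙z≈xz∙y (b + b') (y + y') k))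

+-cancel-inner : (a b l x y : ℕ) → a + (l + x) ≡ b + (l + y) → a + x ≡ b + y
+-cancel-inner a b l x y p =
  +-cancelˡ-≡ l _ _ (trans (+-Props.x∙yz≈y∙xz l a x) (trans p (+-Props.x∙yz≈y∙xz b l y)))

≤-from-balance : (a b l x k : ℕ) → a + (l + k) ≡ b + (x + k) → a ≤ b + x
≤-from-balance a b l x k p =
  ≤-trans (m≤m+n a l) (≤-reflexive (+-cancelʳ-≡ k _ _ (trans (+-assoc a l k) (trans p (sym (+-assoc b x k))))))

duplication-size : (r x y wx wy wxy : ℕ) → wx + wy < wxy → r + x + wx + y + wy < r + (x + y) + wxy
duplication-size r x y wx wy wxy h = transport (_< r + (x + y) + wxy) (sym (regroup r x y wx wy)) (+-monoʳ-< (r + (x + y)) h)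
  where
  regroup : ∀ r x y wx wy → r + x + wx + y + wy ≡ r + (x + y) + (wx + wy)
  regroup = solve-∀

if-[] : (b : Bool) → _≡_ {A = List A} (if b then [] else []) []
if-[] true  = refl
if-[] false = refl

if-++ : (b : Bool) (X Y : List A) → (if b then X ++ Y else []) ≡ (if b then X else []) ++ (if b then Y else [])
if-++ true  X Y = refl
if-++ false X Y = refl

infix 4 _⊆ₘ_
_⊆ₘ_ : List A → List A → Set
X ⊆ₘ Y = ∃ λ Z → Y ↭ X ++ Z

⊆ₘ-refl : (X : List A) → X ⊆ₘ X
⊆ₘ-refl X = [] , ↭-sym (++-identityʳ X)

↭⇒⊆ₘ : {X Y : List A} → X ↭ Y → X ⊆ₘ Y
↭⇒⊆ₘ {X = X} p = [] , ↭-trans (↭-sym p) (↭-sym (++-identityʳ X))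

⊆ₘ-trans : {X Y Z : List A} → X ⊆ₘ Y → Y ⊆ₘ Z → X ⊆ₘ Z
⊆ₘ-trans {X = X} (V , p) (W , q) = V ++ W , ↭-trans q (↭-trans (++⁺ʳ W p) (++-assoc X V W))

++⁺-⊆ₘ : {X Y Z W : List A} → X ⊆ₘ Y → Z ⊆ₘ W → X ++ Z ⊆ₘ Y ++ W
++⁺-⊆ₘ {X = X} {Z = Z} (V , p) (U , q) = V ++ U , ↭-trans (++⁺ p q) (++-Props.interchange X V Z U)

⊆ₘ-++ʳ : (X Y : List A) → X ⊆ₘ X ++ Y
⊆ₘ-++ʳ X Y = Y , ↭-refl

⊆ₘ-∷ : (a : A) (X : List A) → X ⊆ₘ a ∷ X
⊆ₘ-∷ a X = [ a ] , ++-comm [ a ] X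

↭-regroup : {Z W X Y G : List A} → Z ↭ W ++ G → W ↭ X ++ Y → Z ↭ (X ++ G) ++ Y
↭-regroup {X = X} {Y = Y} {G = G} p q = ↭-trans p (↭-trans (++⁺ʳ G q) (++-Props.xy∙z≈xz∙y X Y G))

-- Non-idempotent intersection types

infixr 6 _⇒_
data Ty : Set where
  o   : Ty
  _⇒_ : List Ty → Ty → Ty

Cx : ℕ → Set
Cx n = Fin n → List Ty

private variable
  Γ Δ Θ : Cx n
  t u : Tm n
  σ τ : Ty
  M : List Ty

∅ : Cx n
∅ _ = []

infixl 6 _⊕_
_⊕_ : Cx n → Cx n → Cx n
(Γ ⊕ Δ) y = Γ y ++ Δ y

cvar : Fin n → List Ty → Cx n
cvar x L y = if x == y then L else []

single : Fin n → Ty → Cx n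
single x τ = cvar x [ τ ]

tl : Cx (suc n) → Cx n
tl Γ = Γ ∘ suc

infix 4 _≈_ _⊑_
_≈_ : Cx n → Cx n → Set
Γ ≈ Δ = ∀ y → Γ y ↭ Δ y

_⊑_ : Cx n → Cx n → Set
Γ ⊑ Δ = ∀ y → Γ y ⊆ₘ Δ y

≈-sym : Γ ≈ Δ → Δ ≈ Γ
≈-sym p y = ↭-sym (p y)

≈-trans : Γ ≈ Δ → Δ ≈ Θ → Γ ≈ Θ
≈-trans p q y = ↭-trans (p y) (q y)

≈⇒⊑ : Γ ≈ Δ → Γ ⊑ Δ
≈⇒⊑ p y = ↭⇒⊆ₘ (p y)

⊑-refl : (Γ : Cx n) → Γ ⊑ Γ
⊑-refl Γ y = ⊆ₘ-refl (Γ y)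

⊕⁺-≈ : {Γ Γ' Δ Δ' : Cx n} → Γ ≈ Γ' → Δ ≈ Δ' → Γ ⊕ Δ ≈ Γ' ⊕ Δ'
⊕⁺-≈ p q y = ++⁺ (p y) (q y)

⊕⁺-⊑ : {Γ Γ' Δ Δ' : Cx n} → Γ ⊑ Γ' → Δ ⊑ Δ' → Γ ⊕ Δ ⊑ Γ' ⊕ Δ'
⊕⁺-⊑ p q y = ++⁺-⊆ₘ (p y) (q y)

-- A binder may be assigned more types than its body uses (Γ zero ⊆ₘ M), so that an
-- erased argument can still be typed.
infix 4 _⊢_∶_ _⊢_∶ₘ_
data _⊢_∶_ {n : ℕ} : Cx n → Tm n → Ty → Set
data _⊢_∶ₘ_ {n : ℕ} : Cx n → Tm n → List Ty → Set

data _⊢_∶_ {n} where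
  var : (x : Fin n) (τ : Ty) → single x τ ⊢ var x ∶ τ
  lam : Γ ⊢ t ∶ τ → Γ zero ⊆ₘ M → tl Γ ⊢ lam t ∶ M ⇒ τ
  app : {t u : Tm n} → Γ ⊢ t ∶ (σ ∷ M) ⇒ τ → Δ ⊢ u ∶ₘ σ ∷ M → Γ ⊕ Δ ⊢ app t u ∶ τ
  jmp : {u : Tm n} → Γ ⊢ t ∶ τ → Δ ⊢ u ∶ₘ σ ∷ M → Γ zero ⊆ₘ σ ∷ M → tl Γ ⊕ Δ ⊢ jmp t u ∶ τ

data _⊢_∶ₘ_ {n} where
  []  : {u : Tm n} → ∅ ⊢ u ∶ₘ []
  _∷_ : {u : Tm n} → Γ ⊢ u ∶ σ → Δ ⊢ u ∶ₘ M → Γ ⊕ Δ ⊢ u ∶ₘ σ ∷ M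

weight : List Ty → ℕ
weight M = length M * length M

size  : Γ ⊢ t ∶ τ → ℕ
sizeₘ : Γ ⊢ t ∶ₘ M → ℕ
size (var x τ) = 1
size (lam D _) = size D
size (app {σ = σ} {M = M} D Ds) = size D + sizeₘ Ds + suc (weight (σ ∷ M))
size (jmp {σ = σ} {M = M} D Ds _) = size D + sizeₘ Ds + weight (σ ∷ M)
sizeₘ [] = 0
sizeₘ (D ∷ Ds) = size D + sizeₘ Ds

record Typing (Γ : Cx n) (t : Tm n) (τ : Ty) (s : ℕ) : Set where
  constructor typing
  field
    {ctx} : Cx n
    der   : ctx ⊢ t ∶ τ
    ctx≈  : ctx ≈ Γ
    size≡ : size der ≡ s

record Typingₘ (Γ : Cx n) (t : Tm n) (M : List Ty) (s : ℕ) : Set where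
  constructor typingₘ
  field
    {ctx} : Cx n
    der   : ctx ⊢ t ∶ₘ M
    ctx≈  : ctx ≈ Γ
    size≡ : sizeₘ der ≡ s

renCx : (Fin n → Fin m) → Cx n → Cx m
renCx ρ Γ y = concatF (λ x → if ρ x == y then Γ x else [])

renCx-cvar : (ρ : Fin n → Fin m) (x : Fin n) (L : List Ty) → renCx ρ (cvar x L) ≈ cvar (ρ x) L
renCx-cvar ρ x L y =
  ↭-trans (concatF-only x _ off) (↭-reflexive (cong (λ b → if ρ x == y then (if b then L else []) else []) (==-refl x)))
  where
  off : ∀ x' → (x == x') ≡ false → (if ρ x' == y then cvar x L x' else []) ≡ []
  off x' e rewrite e = if-[] (ρ x' == y)

renCx-⊕ : (ρ : Fin n → Fin m) (Γ Δ : Cx n) → renCx ρ (Γ ⊕ Δ) ≈ renCx ρ Γ ⊕ renCx ρ Δ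
renCx-⊕ {n = n} ρ Γ Δ y =
  ↭-trans (concatF-cong (λ x → ↭-reflexive (if-++ (ρ x == y) (Γ x) (Δ x)))) (concatF-++ {n = n} _ _)

renCx-∅ : (ρ : Fin n → Fin m) → renCx ρ ∅ ≈ ∅
renCx-∅ ρ y = ↭-reflexive (concatF-[] (λ x → if-[] (ρ x == y)))

renCx-lift-zero : (ρ : Fin n → Fin m) (Γ : Cx (suc n)) → renCx (lift ρ) Γ zero ↭ Γ zero
renCx-lift-zero {n = n} ρ Γ =
  ↭-trans (↭-reflexive (cong (Γ zero ++_) (concatF-[] {n = n} (λ _ → refl)))) (++-identityʳ (Γ zero))

renCx-suc-zero : (ρ : Fin n → Fin m) (Γ : Cx n) → renCx (λ x → suc (ρ x)) Γ zero ≡ []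
renCx-suc-zero {n = n} ρ Γ = concatF-[] {n = n} (λ _ → refl)

renCx-suc : (Γ : Cx n) (y : Fin n) → renCx suc Γ (suc y) ↭ Γ y
renCx-suc Γ y = concatF-select y Γ

renCx-id : (Γ : Cx n) → renCx id Γ ≈ Γ
renCx-id Γ y = concatF-select y Γ

renCx-merge-zero : (Γ : Cx (suc (suc n))) → renCx merge Γ zero ↭ Γ zero ++ Γ (suc zero)
renCx-merge-zero {n = n} Γ =
  ↭-trans (↭-reflexive (cong (λ X → Γ zero ++ Γ (suc zero) ++ X) (concatF-[] {n = n} (λ _ → refl))))
          (++⁺ˡ (Γ zero) (++-identityʳ (Γ (suc zero))))

renCx-merge-suc : (Γ : Cx (suc (suc n))) (y : Fin n) → renCx merge Γ (suc y) ↭ Γ (suc (suc y))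
renCx-merge-suc Γ y = concatF-select y (λ z → Γ (suc (suc z)))

ren-typing  : (ρ : Fin n → Fin m) (D : Γ ⊢ t ∶ τ) → Typing (renCx ρ Γ) (ren ρ t) τ (size D)
ren-typingₘ : (ρ : Fin n → Fin m) (Ds : Γ ⊢ t ∶ₘ M) → Typingₘ (renCx ρ Γ) (ren ρ t) M (sizeₘ Ds)
ren-typing ρ (var x τ) = typing (var (ρ x) τ) (≈-sym (renCx-cvar ρ x [ τ ])) refl
ren-typing ρ (lam {Γ = Γ} D bc) with ren-typing (lift ρ) D
... | typing D' e s = typing (lam D' (⊆ₘ-trans (↭⇒⊆ₘ (↭-trans (e zero) (renCx-lift-zero ρ Γ))) bc)) (e ∘ suc) s
ren-typing ρ (app {Γ = Γ} {Δ = Δ} D Ds) with ren-typing ρ D | ren-typingₘ ρ Ds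
... | typing D' e s | typingₘ Ds' e' s' =
  typing (app D' Ds') (≈-trans (⊕⁺-≈ e e') (≈-sym (renCx-⊕ ρ Γ Δ))) (cong₂ (λ a b → a + b + _) s s')
ren-typing ρ (jmp {Γ = Γ} {Δ = Δ} D Ds bc) with ren-typing (lift ρ) D | ren-typingₘ ρ Ds
... | typing D' e s | typingₘ Ds' e' s' =
  typing (jmp D' Ds' (⊆ₘ-trans (↭⇒⊆ₘ (↭-trans (e zero) (renCx-lift-zero ρ Γ))) bc))
         (≈-trans (⊕⁺-≈ (e ∘ suc) e') (≈-sym (renCx-⊕ ρ (tl Γ) Δ))) (cong₂ (λ a b → a + b + _) s s')
ren-typingₘ ρ [] = typingₘ [] (≈-sym (renCx-∅ ρ)) refl
ren-typingₘ ρ (_∷_ {Γ = Γ} {Δ = Δ} D Ds) with ren-typing ρ D | ren-typingₘ ρ Ds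
... | typing D' e s | typingₘ Ds' e' s' =
  typingₘ (D' ∷ Ds') (≈-trans (⊕⁺-≈ e e') (≈-sym (renCx-⊕ ρ Γ Δ))) (cong₂ _+_ s s')

unren-typing  : (ρ : Fin n → Fin m) (t : Tm n) {Γ' : Cx m} (D : Γ' ⊢ ren ρ t ∶ τ) →
                Σ[ Γ ∈ Cx n ] Σ[ D₀ ∈ Γ ⊢ t ∶ τ ] Γ' ≈ renCx ρ Γ × size D₀ ≡ size D
unren-typingₘ : (ρ : Fin n → Fin m) (t : Tm n) {Γ' : Cx m} (Ds : Γ' ⊢ ren ρ t ∶ₘ M) →
                Σ[ Γ ∈ Cx n ] Σ[ Ds₀ ∈ Γ ⊢ t ∶ₘ M ] Γ' ≈ renCx ρ Γ × sizeₘ Ds₀ ≡ sizeₘ Ds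
unren-typing ρ (var x) (var _ τ) = single x τ , var x τ , ≈-sym (renCx-cvar ρ x [ τ ]) , refl
unren-typing ρ (lam t) (lam D bc) with unren-typing (lift ρ) t D
... | Γ , D₀ , e , s =
  tl Γ , lam D₀ (⊆ₘ-trans (↭⇒⊆ₘ (↭-sym (↭-trans (e zero) (renCx-lift-zero ρ Γ)))) bc) , e ∘ suc , s
unren-typing ρ (app t u) (app D Ds) with unren-typing ρ t D | unren-typingₘ ρ u Ds
... | Γ , D₀ , e , s | Δ , Ds₀ , e' , s' =
  Γ ⊕ Δ , app D₀ Ds₀ , ≈-trans (⊕⁺-≈ e e') (≈-sym (renCx-⊕ ρ Γ Δ)) , cong₂ (λ a b → a + b + _) s s'
unren-typing ρ (jmp t u) (jmp D Ds bc) with unren-typing (lift ρ) t D | unren-typingₘ ρ u Ds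
... | Γ , D₀ , e , s | Δ , Ds₀ , e' , s' =
  tl Γ ⊕ Δ , jmp D₀ Ds₀ (⊆ₘ-trans (↭⇒⊆ₘ (↭-sym (↭-trans (e zero) (renCx-lift-zero ρ Γ)))) bc) ,
  ≈-trans (⊕⁺-≈ (e ∘ suc) e') (≈-sym (renCx-⊕ ρ (tl Γ) Δ)) , cong₂ (λ a b → a + b + _) s s'
unren-typingₘ ρ t [] = ∅ , [] , ≈-sym (renCx-∅ ρ) , refl
unren-typingₘ ρ t (D ∷ Ds) with unren-typing ρ t D | unren-typingₘ ρ t Ds
... | Γ , D₀ , e , s | Δ , Ds₀ , e' , s' =
  Γ ⊕ Δ , D₀ ∷ Ds₀ , ≈-trans (⊕⁺-≈ e e') (≈-sym (renCx-⊕ ρ Γ Δ)) , cong₂ _+_ s s'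

[]ₘ-ctx : Θ ⊢ u ∶ₘ [] → ∀ y → Θ y ≡ []
[]ₘ-ctx [] y = refl

[]ₘ-size : (Ds : Θ ⊢ u ∶ₘ []) → sizeₘ Ds ≡ 0
[]ₘ-size [] = refl

singletonₘ : (Ds : Θ ⊢ u ∶ₘ [ τ ]) → Typing Θ u τ (sizeₘ Ds)
singletonₘ (_∷_ {Γ = Γ} D []) = typing D (λ y → ↭-sym (++-identityʳ (Γ y))) (sym (+-identityʳ _))

infixr 5 _++ₘ_
_++ₘ_ : {Θ₁ Θ₂ : Cx n} {X Y : List Ty} (Ds₁ : Θ₁ ⊢ u ∶ₘ X) (Ds₂ : Θ₂ ⊢ u ∶ₘ Y) →
        Typingₘ (Θ₁ ⊕ Θ₂) u (X ++ Y) (sizeₘ Ds₁ + sizeₘ Ds₂)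
[] ++ₘ Ds₂ = typingₘ Ds₂ (λ y → ↭-refl) refl
(_∷_ {Γ = Γ} {Δ = Δ} D Ds₁) ++ₘ Ds₂ with Ds₁ ++ₘ Ds₂
... | typingₘ Ds e s =
  typingₘ (D ∷ Ds) (λ y → ↭-trans (++⁺ˡ (Γ y) (e y)) (↭-sym (++-assoc (Γ y) (Δ y) _)))
          (trans (cong (size D +_) s) (sym (+-assoc (size D) _ _)))

record Split (Θ : Cx n) (u : Tm n) (X Y : List Ty) (s : ℕ) : Set where
  constructor split
  field
    {ctxˡ ctxʳ} : Cx n
    left  : ctxˡ ⊢ u ∶ₘ X
    right : ctxʳ ⊢ u ∶ₘ Y
    ctx≈  : Θ ≈ ctxˡ ⊕ ctxʳ
    size≡ : sizeₘ left + sizeₘ right ≡ s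

split-++ : (X Y : List Ty) (Ds : Θ ⊢ u ∶ₘ X ++ Y) → Split Θ u X Y (sizeₘ Ds)
split-++ [] Y Ds = split [] Ds (λ y → ↭-refl) refl
split-++ (_ ∷ X) Y (_∷_ {Γ = Γ} D Ds) with split-++ X Y Ds
... | split L R e s =
  split (D ∷ L) R (λ y → ↭-trans (++⁺ˡ (Γ y) (e y)) (↭-sym (++-assoc (Γ y) _ _)))
        (trans (+-assoc (size D) _ _) (cong (size D +_) s))

permₘ : {X Y : List Ty} → X ↭ Y → (Ds : Θ ⊢ u ∶ₘ X) → Typingₘ Θ u Y (sizeₘ Ds)
permₘ ↭-prefl Ds = typingₘ Ds (λ y → ↭-refl) refl
permₘ (prep _ p) (_∷_ {Γ = Γ} D Ds) with permₘ p Ds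
... | typingₘ Ds' e s = typingₘ (D ∷ Ds') (λ y → ++⁺ˡ (Γ y) (e y)) (cong (size D +_) s)
permₘ (swap _ _ p) (_∷_ {Γ = Γ₁} D₁ (_∷_ {Γ = Γ₂} D₂ Ds)) with permₘ p Ds
... | typingₘ Ds' e s =
  typingₘ (D₂ ∷ D₁ ∷ Ds') (λ y → ↭-trans (shifts (Γ₂ y) (Γ₁ y)) (++⁺ˡ (Γ₁ y) (++⁺ˡ (Γ₂ y) (e y))))
          (trans (+-Props.x∙yz≈y∙xz (size D₂) (size D₁) _) (cong (λ k → size D₁ + (size D₂ + k)) s))
permₘ (↭-ptrans p q) Ds with permₘ p Ds
... | typingₘ Ds₁ e₁ s₁ with permₘ q Ds₁
... | typingₘ Ds₂ e₂ s₂ = typingₘ Ds₂ (≈-trans e₂ e₁) (trans s₂ s₁)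

splitₘ : {X Y : List Ty} (Ds : Θ ⊢ u ∶ₘ M) → M ↭ X ++ Y → Split Θ u X Y (sizeₘ Ds)
splitₘ {X = X} {Y = Y} Ds p with permₘ p Ds
... | typingₘ Ds' e s with split-++ X Y Ds'
... | split L R e' s' = split L R (≈-trans (≈-sym e) e') (trans s' s)

cvar-∷ : (x : Fin n) (τ : Ty) {L : List Ty} → Θ ≈ cvar x L → single x τ ⊕ Θ ≈ cvar x (τ ∷ L)
cvar-∷ x τ e y with x == y | e y
... | true  | p = prep τ p
... | false | p = p

varₘ : (x : Fin n) (L : List Ty) → Typingₘ (cvar x L) (var x) L (length L)
varₘ x [] = typingₘ [] (λ y → ↭-reflexive (sym (if-[] (x == y)))) refl
varₘ x (τ ∷ L) with varₘ x L
... | typingₘ Ds e s = typingₘ (var x τ ∷ Ds) (cvar-∷ x τ e) (cong suc s)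

varₘ-inv : {z : Fin n} {L : List Ty} → Θ ⊢ var z ∶ₘ L → Θ ≈ cvar z L
varₘ-inv {z = z} [] y = ↭-reflexive (sym (if-[] (z == y)))
varₘ-inv (var z τ ∷ Ds) = cvar-∷ z τ (varₘ-inv Ds)

eqFin≤single : (x y : Fin n) (τ : Ty) → eqFin x y ≤ length (single y τ x)
eqFin≤single zero    zero    τ = ≤-refl
eqFin≤single zero    (suc y) τ = z≤n
eqFin≤single (suc x) zero    τ = z≤n
eqFin≤single (suc x) (suc y) τ = eqFin≤single x y τ

occ≤  : Γ ⊢ t ∶ τ → ∀ x → occ t x ≤ length (Γ x)
occₘ≤ : Γ ⊢ t ∶ₘ σ ∷ M → ∀ x → occ t x ≤ length (Γ x)
occ≤ (var y τ) x = eqFin≤single x y τ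
occ≤ (lam D _) x = occ≤ D (suc x)
occ≤ (app {Γ = Γ} D Ds) x =
  ≤-trans (+-mono-≤ (occ≤ D x) (occₘ≤ Ds x)) (≤-reflexive (sym (length-++ (Γ x))))
occ≤ (jmp {Γ = Γ} D Ds _) x =
  ≤-trans (+-mono-≤ (occ≤ D (suc x)) (occₘ≤ Ds x)) (≤-reflexive (sym (length-++ (Γ (suc x)))))
occₘ≤ (_∷_ {Γ = Γ} D Ds) x =
  ≤-trans (occ≤ D x) (≤-trans (m≤m+n _ _) (≤-reflexive (sym (length-++ (Γ x)))))

-- Substitution

card : Cx n → ℕ
card Γ = sumF (length ∘ Γ)

card-⊕ : (Γ Δ : Cx n) → card (Γ ⊕ Δ) ≡ card Γ + card Δ
card-⊕ Γ Δ = trans (sumF-cong (λ x → length-++ (Γ x))) (sumF-+ (length ∘ Γ) (length ∘ Δ))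

card-single : (x : Fin n) (τ : Ty) → card (single x τ) ≡ 1
card-single x τ = trans (sumF-only x _ (λ x' e → cong (λ b → length (if b then [ τ ] else [])) e))
                        (cong (λ b → length (if b then [ τ ] else [])) (==-refl x))

infixr 5 _▹_
_▹_ : List Ty → Cx n → Cx (suc n)
(L ▹ Γ) zero    = L
(L ▹ Γ) (suc y) = Γ y

record SubTyping (θ : Fin n → Tm m) (Γ : Cx n) : Set where
  constructor subTyping
  field
    ctxs : Fin n → Cx m
    ders : (x : Fin n) → ctxs x ⊢ θ x ∶ₘ Γ x

  ctxₛ : Cx m
  ctxₛ y = concatF (λ x → ctxs x y)

  sizeₛ : ℕ
  sizeₛ = sumF (λ x → sizeₘ (ders x))

open SubTyping public

emptyₛ : {θ : Fin n → Tm m} → SubTyping θ ∅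
emptyₛ = subTyping (λ _ → ∅) (λ _ → [])

emptyₛ-ctx : {θ : Fin n → Tm m} → ctxₛ (emptyₛ {θ = θ}) ≈ ∅
emptyₛ-ctx {n = n} y = ↭-reflexive (concatF-[] {n = n} (λ _ → refl))

splitₛ : {θ : Fin n → Tm m} (S : SubTyping θ (Γ ⊕ Δ)) →
         Σ[ S₁ ∈ SubTyping θ Γ ] Σ[ S₂ ∈ SubTyping θ Δ ]
           ctxₛ S ≈ ctxₛ S₁ ⊕ ctxₛ S₂ × sizeₛ S₁ + sizeₛ S₂ ≡ sizeₛ S
splitₛ {n = n} {Γ = Γ} {Δ = Δ} {θ = θ} S =
  subTyping _ (Split.left ∘ halves) , subTyping _ (Split.right ∘ halves) ,
  (λ y → ↭-trans (concatF-cong (λ x → Split.ctx≈ (halves x) y)) (concatF-++ {n = n} _ _)) ,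
  trans (sym (sumF-+ {n = n} _ _)) (sumF-cong (Split.size≡ ∘ halves))
  where
  halves : (x : Fin n) → Split (ctxs S x) (θ x) (Γ x) (Δ x) (sizeₘ (ders S x))
  halves x = splitₘ (ders S x) ↭-refl

joinₛ : {θ : Fin n → Tm m} (S₁ : SubTyping θ Γ) (S₂ : SubTyping θ Δ) →
        Σ[ S ∈ SubTyping θ (Γ ⊕ Δ) ] ctxₛ S ≈ ctxₛ S₁ ⊕ ctxₛ S₂
joinₛ {n = n} {Γ = Γ} {Δ = Δ} {θ = θ} S₁ S₂ =
  subTyping _ (Typingₘ.der ∘ joined) ,
  λ y → ↭-trans (concatF-cong (λ x → Typingₘ.ctx≈ (joined x) y)) (concatF-++ {n = n} _ _)
  where
  joined : (x : Fin n) → Typingₘ (ctxs S₁ x ⊕ ctxs S₂ x) (θ x) (Γ x ++ Δ x) _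
  joined x = ders S₁ x ++ₘ ders S₂ x

liftₛ : {θ : Fin n → Tm m} → SubTyping θ (tl Γ) → SubTyping (liftS θ) Γ
ctxs (liftₛ {Γ = Γ} S) zero    = Typingₘ.ctx (varₘ zero (Γ zero))
ctxs (liftₛ S)         (suc x) = Typingₘ.ctx (ren-typingₘ suc (ders S x))
ders (liftₛ {Γ = Γ} S) zero    = Typingₘ.der (varₘ zero (Γ zero))
ders (liftₛ S)         (suc x) = Typingₘ.der (ren-typingₘ suc (ders S x))

lifted-ctx : {Ξ : Fin (suc n) → Cx (suc m)} {Θ : Fin n → Cx m} {L : List Ty} →
             Ξ zero ≈ cvar zero L → (∀ x → Ξ (suc x) ≈ renCx suc (Θ x)) →
             (λ y → concatF (λ x → Ξ x y)) ≈ L ▹ (λ y → concatF (λ x → Θ x y))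
lifted-ctx {n = n} {Θ = Θ} {L = L} e₀ e zero =
  ↭-trans (++⁺ (e₀ zero) (↭-trans (concatF-cong (λ x → ↭-trans (e x zero) (↭-reflexive (renCx-suc-zero id (Θ x)))))
                                  (↭-reflexive (concatF-[] {n = n} (λ _ → refl)))))
          (++-identityʳ L)
lifted-ctx {Θ = Θ} e₀ e (suc y) = ++⁺ (e₀ (suc y)) (concatF-cong (λ x → ↭-trans (e x (suc y)) (renCx-suc (Θ x) y)))

liftₛ-ctx : {θ : Fin n → Tm m} (S : SubTyping θ (tl Γ)) → ctxₛ (liftₛ {Γ = Γ} S) ≈ Γ zero ▹ ctxₛ S
liftₛ-ctx {Γ = Γ} S =
  lifted-ctx {Ξ = ctxs (liftₛ {Γ = Γ} S)} (Typingₘ.ctx≈ (varₘ zero (Γ zero)))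
             (λ x → Typingₘ.ctx≈ (ren-typingₘ suc (ders S x)))

liftₛ-size : {θ : Fin n → Tm m} (S : SubTyping θ (tl Γ)) → sizeₛ (liftₛ {Γ = Γ} S) ≡ length (Γ zero) + sizeₛ S
liftₛ-size {Γ = Γ} S =
  cong₂ _+_ (Typingₘ.size≡ (varₘ zero (Γ zero))) (sumF-cong (λ x → Typingₘ.size≡ (ren-typingₘ suc (ders S x))))

sub0ₛ : (Ds : Θ ⊢ u ∶ₘ Γ zero) → SubTyping (sub0 u) Γ
ctxs (sub0ₛ {Θ = Θ} Ds) zero    = Θ
ctxs (sub0ₛ {Γ = Γ} Ds) (suc x) = Typingₘ.ctx (varₘ x (Γ (suc x)))
ders (sub0ₛ Ds)         zero    = Ds
ders (sub0ₛ {Γ = Γ} Ds) (suc x) = Typingₘ.der (varₘ x (Γ (suc x)))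

sub0ₛ-ctx : (Ds : Θ ⊢ u ∶ₘ Γ zero) → ctxₛ (sub0ₛ {Γ = Γ} Ds) ≈ Θ ⊕ tl Γ
sub0ₛ-ctx {Θ = Θ} {Γ = Γ} Ds y =
  ++⁺ˡ (Θ y) (↭-trans (concatF-cong (λ x → Typingₘ.ctx≈ (varₘ x (Γ (suc x))) y)) (concatF-select y (tl Γ)))

sub0ₛ-size : (Ds : Θ ⊢ u ∶ₘ Γ zero) → sizeₛ (sub0ₛ {Γ = Γ} Ds) ≡ sizeₘ Ds + card (tl Γ)
sub0ₛ-size {Γ = Γ} Ds = cong (sizeₘ Ds +_) (sumF-cong (λ x → Typingₘ.size≡ (varₘ x (Γ (suc x)))))

pointₛ : {θ : Fin n → Tm m} {Γ' : Cx m} {τ : Ty} (x : Fin n) → Γ' ⊢ θ x ∶ τ → SubTyping θ (single x τ)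
pointₛ {θ = θ} {Γ' = Γ'} {τ = τ} x D = subTyping (λ x' → if x == x' then Γ' ⊕ ∅ else ∅) at
  where
  at : ∀ x' → (if x == x' then Γ' ⊕ ∅ else ∅) ⊢ θ x' ∶ₘ single x τ x'
  at x' with x == x' in eq
  ... | true  = transport (λ z → Γ' ⊢ θ z ∶ τ) (==-sound x x' eq) D ∷ []
  ... | false = []

pointₛ-ctx : {θ : Fin n → Tm m} {Γ' : Cx m} (x : Fin n) (D : Γ' ⊢ θ x ∶ τ) → ctxₛ (pointₛ {θ = θ} x D) ≈ Γ'
pointₛ-ctx {Γ' = Γ'} x D y = ↭-trans (concatF-only x _ off) at-x
  where
  off : ∀ x' → (x == x') ≡ false → (if x == x' then Γ' ⊕ ∅ else ∅) y ≡ []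
  off x' e rewrite e = refl
  at-x : (if x == x then Γ' ⊕ ∅ else ∅) y ↭ Γ' y
  at-x rewrite ==-refl x = ++-identityʳ (Γ' y)

unliftₛ : {θ : Fin n → Tm m} → SubTyping (liftS θ) Γ → SubTyping θ (tl Γ)
ctxs (unliftₛ S) x = proj₁ (unren-typingₘ suc _ (ders S (suc x)))
ders (unliftₛ S) x = proj₁ (proj₂ (unren-typingₘ suc _ (ders S (suc x))))

unliftₛ-ctx : {θ : Fin n → Tm m} (S : SubTyping (liftS θ) Γ) → ctxₛ S ≈ Γ zero ▹ ctxₛ (unliftₛ S)
unliftₛ-ctx S =
  lifted-ctx {Ξ = ctxs S} (varₘ-inv (ders S zero)) (λ x → proj₁ (proj₂ (proj₂ (unren-typingₘ suc _ (ders S (suc x))))))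

singleton-if : {b : Bool} → b ≡ true → (Ds : Θ ⊢ u ∶ₘ (if b then [ τ ] else [])) → Typing Θ u τ (sizeₘ Ds)
singleton-if refl Ds = singletonₘ Ds

empty-if-ctx : {b : Bool} {L : List Ty} → b ≡ false → Θ ⊢ u ∶ₘ (if b then L else []) → ∀ y → Θ y ≡ []
empty-if-ctx refl Ds = []ₘ-ctx Ds

empty-if-size : {b : Bool} {L : List Ty} → b ≡ false → (Ds : Θ ⊢ u ∶ₘ (if b then L else [])) → sizeₘ Ds ≡ 0
empty-if-size refl Ds = []ₘ-size Ds

single-subₛ : {θ : Fin n → Tm m} (x : Fin n) (S : SubTyping θ (single x τ)) → Typing (ctxₛ S) (θ x) τ (sizeₛ S)
single-subₛ x S with singleton-if (==-refl x) (ders S x)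
... | typing D e s =
  typing D (λ y → ↭-trans (e y) (↭-sym (concatF-only x (λ x' → ctxs S x' y) (λ x' b → empty-if-ctx b (ders S x') y))))
           (trans s (sym (sumF-only x _ (λ x' b → empty-if-size b (ders S x')))))

-- Each of the card Γ variable axioms of D (of size 1) is replaced by a derivation from S.
subst-typing       : {θ : Fin n → Tm m} (D : Γ ⊢ t ∶ τ) (S : SubTyping θ Γ) →
                     ∃ λ s → Typing (ctxₛ S) (subst θ t) τ s × s + card Γ ≡ size D + sizeₛ S
subst-typingₘ      : {θ : Fin n → Tm m} (Ds : Γ ⊢ t ∶ₘ M) (S : SubTyping θ Γ) →
                     ∃ λ s → Typingₘ (ctxₛ S) (subst θ t) M s × s + card Γ ≡ sizeₘ Ds + sizeₛ S
subst-typing-under : {θ : Fin n → Tm m} (D : Γ ⊢ t ∶ τ) (S : SubTyping θ (tl Γ)) →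
                     ∃ λ s → Typing (Γ zero ▹ ctxₛ S) (subst (liftS θ) t) τ s × s + card (tl Γ) ≡ size D + sizeₛ S

subst-typing {τ = τ} (var x τ) S = sizeₛ S , single-subₛ x S , trans (cong (sizeₛ S +_) (card-single x τ)) (+-comm _ 1)
subst-typing (lam D bc) S with subst-typing-under D S
... | s , typing D' e se , eq = s , typing (lam D' (⊆ₘ-trans (↭⇒⊆ₘ (e zero)) bc)) (e ∘ suc) se , eq
subst-typing (app {Γ = Γ} {Δ = Δ} D Ds) S with splitₛ {Γ = Γ} {Δ = Δ} S
... | S₁ , S₂ , e , sz with subst-typing D S₁ | subst-typingₘ Ds S₂
... | s₁ , typing D' e₁ se₁ , eq₁ | s₂ , typingₘ Ds' e₂ se₂ , eq₂ =
  _ , typing (app D' Ds') (≈-trans (⊕⁺-≈ e₁ e₂) (≈-sym e)) (cong₂ (λ a b → a + b + _) se₁ se₂) ,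
  trans (cong (_ +_) (card-⊕ Γ Δ))
    (trans (+-balance-node _ s₁ (size D) (card Γ) (sizeₛ S₁) s₂ (sizeₘ Ds) (card Δ) (sizeₛ S₂) eq₁ eq₂)
           (cong (_ +_) sz))
subst-typing (jmp {Γ = Γ} {Δ = Δ} D Ds bc) S with splitₛ {Γ = tl Γ} {Δ = Δ} S
... | S₁ , S₂ , e , sz with subst-typing-under D S₁ | subst-typingₘ Ds S₂
... | s₁ , typing D' e₁ se₁ , eq₁ | s₂ , typingₘ Ds' e₂ se₂ , eq₂ =
  _ , typing (jmp D' Ds' (⊆ₘ-trans (↭⇒⊆ₘ (e₁ zero)) bc)) (≈-trans (⊕⁺-≈ (e₁ ∘ suc) e₂) (≈-sym e))
             (cong₂ (λ a b → a + b + _) se₁ se₂) ,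
  trans (cong (_ +_) (card-⊕ (tl Γ) Δ))
    (trans (+-balance-node _ s₁ (size D) (card (tl Γ)) (sizeₛ S₁) s₂ (sizeₘ Ds) (card Δ) (sizeₛ S₂) eq₁ eq₂)
           (cong (_ +_) sz))

subst-typingₘ {n = n} [] S =
  0 , typingₘ [] (λ y → ↭-reflexive (sym (concatF-[] (λ x → []ₘ-ctx (ders S x) y)))) refl ,
  trans (sumF-0 {n = n} (λ _ → refl)) (sym (sumF-0 (λ x → []ₘ-size (ders S x))))
subst-typingₘ (_∷_ {Γ = Γ} {Δ = Δ} D Ds) S with splitₛ {Γ = Γ} {Δ = Δ} S
... | S₁ , S₂ , e , sz with subst-typing D S₁ | subst-typingₘ Ds S₂
... | s₁ , typing D' e₁ se₁ , eq₁ | s₂ , typingₘ Ds' e₂ se₂ , eq₂ =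
  _ , typingₘ (D' ∷ Ds') (≈-trans (⊕⁺-≈ e₁ e₂) (≈-sym e)) (cong₂ _+_ se₁ se₂) ,
  trans (cong (_ +_) (card-⊕ Γ Δ))
    (trans (+-balance s₁ (size D) (card Γ) (sizeₛ S₁) s₂ (sizeₘ Ds) (card Δ) (sizeₛ S₂) eq₁ eq₂) (cong (_ +_) sz))

subst-typing-under {Γ = Γ} D S with subst-typing D (liftₛ {Γ = Γ} S)
... | s , typing D' e se , eq =
  s , typing D' (≈-trans e (liftₛ-ctx {Γ = Γ} S)) se ,
  +-cancel-inner s (size D) (length (Γ zero)) _ _ (trans eq (cong (size D +_) (liftₛ-size {Γ = Γ} S)))

AntiSubst : (θ : Fin n → Tm m) (t : Tm n) (Γ' : Cx m) (τ : Ty) → Set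
AntiSubst {n = n} θ t Γ' τ = Σ[ Γ ∈ Cx n ] Σ[ D ∈ Γ ⊢ t ∶ τ ] Σ[ S ∈ SubTyping θ Γ ] Γ' ≈ ctxₛ S

AntiSubstₘ : (θ : Fin n → Tm m) (t : Tm n) (Γ' : Cx m) (M : List Ty) → Set
AntiSubstₘ {n = n} θ t Γ' M = Σ[ Γ ∈ Cx n ] Σ[ Ds ∈ Γ ⊢ t ∶ₘ M ] Σ[ S ∈ SubTyping θ Γ ] Γ' ≈ ctxₛ S

anti-subst  : (θ : Fin n → Tm m) {Γ' : Cx m} → Pure t → Γ' ⊢ subst θ t ∶ τ → AntiSubst θ t Γ' τ
anti-substₘ : (θ : Fin n → Tm m) {Γ' : Cx m} → Pure t → Γ' ⊢ subst θ t ∶ₘ M → AntiSubstₘ θ t Γ' M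
anti-subst {τ = τ} θ (var x) D = single x τ , var x τ , pointₛ x D , ≈-sym (pointₛ-ctx {θ = θ} x D)
anti-subst θ (lam p) (lam D bc) with anti-subst (liftS θ) p D
... | Γ , D₀ , S , e =
  tl Γ , lam D₀ (⊆ₘ-trans (↭⇒⊆ₘ (↭-sym (↭-trans (e zero) (unliftₛ-ctx S zero)))) bc) , unliftₛ S ,
  λ y → ↭-trans (e (suc y)) (unliftₛ-ctx S (suc y))
anti-subst θ (app p q) (app D Ds) with anti-subst θ p D | anti-substₘ θ q Ds
... | Γ , D₀ , S , e | Δ , Ds₀ , S' , e' with joinₛ S S'
... | S'' , e'' = Γ ⊕ Δ , app D₀ Ds₀ , S'' , ≈-trans (⊕⁺-≈ e e') (≈-sym e'')
anti-substₘ {n = n} θ p [] = ∅ , [] , emptyₛ , ≈-sym (emptyₛ-ctx {n = n} {θ = θ})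
anti-substₘ θ p (D ∷ Ds) with anti-subst θ p D | anti-substₘ θ p Ds
... | Γ , D₀ , S , e | Δ , Ds₀ , S' , e' with joinₛ S S'
... | S'' , e'' = Γ ⊕ Δ , D₀ ∷ Ds₀ , S'' , ≈-trans (⊕⁺-≈ e e') (≈-sym e'')

-- Soundness: typable terms are λj-strongly normalising

record Reduct {n : ℕ} {Γ : Cx n} {t : Tm n} {τ : Ty} (D : Γ ⊢ t ∶ τ) (t' : Tm n) : Set where
  constructor reduct
  field
    {ctx}   : Cx n
    der     : ctx ⊢ t' ∶ τ
    ctx⊑    : ctx ⊑ Γ
    smaller : size der < size D

typing-dB : {k : ℕ} (L : Jumps n m) (ρ : Fin k → Fin n) {t : Tm (suc m)} {u : Tm k} {Δ : Cx k}
            (P : Γ ⊢ plug L (lam t) ∶ (σ ∷ M) ⇒ τ) (Ds : Δ ⊢ u ∶ₘ σ ∷ M) →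
            Typing (Γ ⊕ renCx ρ Δ) (plug L (jmp t (ren (wkJ L ∘ ρ) u))) τ (size P + sizeₘ Ds + weight (σ ∷ M))
typing-dB [] ρ (lam {Γ = Γ} Dt bc) Ds with ren-typingₘ ρ Ds
... | typingₘ Ds' e s = typing (jmp Dt Ds' bc) (λ y → ++⁺ˡ (Γ (suc y)) (e y)) (cong (λ z → size Dt + z + _) s)
typing-dB (_ ∷ L) ρ {Δ = Δ} (jmp {Γ = Γ} {Δ = E} P Es bc) Ds with typing-dB L (λ x → suc (ρ x)) P Ds
... | typing {Γq} Q e s =
  typing (jmp Q Es (⊆ₘ-trans (↭⇒⊆ₘ Q-zero) bc))
         (λ y → ↭-trans (++⁺ʳ (E y) (e (suc y))) (++-Props.xy∙z≈xz∙y (Γ (suc y)) _ (E y)))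
         (trans (cong (λ z → z + sizeₘ Es + _) s) (shuffle (size P) (sizeₘ Ds) _ (sizeₘ Es) _))
  where
  Q-zero : Γq zero ↭ Γ zero
  Q-zero = ↭-trans (e zero) (↭-trans (++⁺ˡ (Γ zero) (↭-reflexive (renCx-suc-zero ρ Δ))) (++-identityʳ (Γ zero)))
  shuffle : ∀ a b c d e → a + b + c + d + e ≡ a + d + e + b + c
  shuffle = solve-∀

reduct-dB : {m : ℕ} (L : Jumps n m) (t : Tm (suc m)) (u : Tm n) (D : Γ ⊢ app (plug L (lam t)) u ∶ τ) →
            Reduct D (plug L (jmp t (ren (wkJ L) u)))
reduct-dB L t u (app {Δ = Δ} P Ds) with typing-dB L id P Ds
... | typing Q e s =
  reduct Q (≈⇒⊑ (≈-trans e (⊕⁺-≈ (λ _ → ↭-refl) (renCx-id Δ))))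
           (≤-reflexive (trans (cong suc s) (sym (+-suc _ _))))

reduct-w : (t' : Tm n) (D : Γ ⊢ jmp (ren suc t') u ∶ τ) → Reduct D t'
reduct-w t' (jmp {Γ = Γ} {Δ = Δ} Dt Ds _) with unren-typing suc t' Dt
... | Γ₀ , D₀ , e , s =
  reduct D₀ (λ y → ⊆ₘ-trans (↭⇒⊆ₘ (↭-sym (↭-trans (e (suc y)) (renCx-suc Γ₀ y))))
                             (⊆ₘ-++ʳ (Γ (suc y)) (Δ y)))
            (≤-<-trans (≤-trans (≤-reflexive s) (m≤m+n (size Dt) (sizeₘ Ds))) (m<m+n _ (s≤s z≤n)))

reduct-d : (t : Tm (suc n)) (D : Γ ⊢ jmp t u ∶ τ) → Reduct D (t ⟨0≔ u ⟩)
reduct-d t (jmp {Γ = Γ} {Δ = Δ} Dt Ds (G , p)) with splitₘ Ds p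
... | split {Θ₀} {Θg} Ds₀ Dg e s with subst-typing Dt (sub0ₛ {Γ = Γ} Ds₀)
... | s' , typing {Γ'} D' e' se , eq = reduct D' ctx⊑ (≤-<-trans size≤ (m<m+n _ (s≤s z≤n)))
  where
  ctx⊑ : Γ' ⊑ tl Γ ⊕ Δ
  ctx⊑ y =
    ⊆ₘ-trans (↭⇒⊆ₘ (↭-trans (e' y) (↭-trans (sub0ₛ-ctx {Γ = Γ} Ds₀ y) (++-comm (Θ₀ y) (Γ (suc y))))))
      (⊆ₘ-trans (++⁺-⊆ₘ (⊆ₘ-refl (Γ (suc y))) (⊆ₘ-++ʳ (Θ₀ y) (Θg y)))
                (↭⇒⊆ₘ (++⁺ˡ (Γ (suc y)) (↭-sym (e y)))))
  size≤ : size D' ≤ size Dt + sizeₘ Ds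
  size≤ = ≤-trans (≤-reflexive se)
            (≤-trans (≤-from-balance s' (size Dt) (length (Γ zero)) (sizeₘ Ds₀) (card (tl Γ))
                        (trans eq (cong (size Dt +_) (sub0ₛ-size {Γ = Γ} Ds₀))))
                     (+-monoʳ-≤ (size Dt) (≤-trans (m≤m+n (sizeₘ Ds₀) (sizeₘ Dg)) (≤-reflexive s))))

nonempty : {X : List A} → 1 ≤ length X → Σ[ a ∈ A ] Σ[ X' ∈ List A ] X ≡ a ∷ X'
nonempty {X = a ∷ X'} _ = a , X' , refl

weight-↭ : {X Y : List Ty} → X ↭ Y → weight X ≡ weight Y
weight-↭ p = cong (λ l → l * l) (↭-length p)

weight-++-< : (a b : Ty) (X Y : List Ty) → weight (a ∷ X) + weight (b ∷ Y) < weight (a ∷ X ++ b ∷ Y)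
weight-++-< a b X Y rewrite length-++ X {b ∷ Y} = square-split (length X) (length Y)
  where
  expand : ∀ i j → (1 + (i + (1 + j))) * (1 + (i + (1 + j)))
                 ≡ 1 + (1 + i) * (1 + i) + (1 + j) * (1 + j) + (1 + (i + i + j + j + 2 * i * j))
  expand = solve-∀
  square-split : ∀ i j → suc i * suc i + suc j * suc j < suc (i + suc j) * suc (i + suc j)
  square-split i j = ≤-trans (m≤m+n _ _) (≤-reflexive (sym (expand i j)))

typing-c : {t' : Tm (suc (suc n))} {Γ₀ : Cx (suc (suc n))} {Θx Θy : Cx n} {a b : Ty} {A B G : List Ty}
           (D₀ : Γ₀ ⊢ t' ∶ τ) → Γ₀ zero ≡ a ∷ A → Γ₀ (suc zero) ≡ b ∷ B →
           (Dsx : Θx ⊢ u ∶ₘ a ∷ A ++ G) (Dsy : Θy ⊢ u ∶ₘ b ∷ B) →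
           Typing (tl (tl Γ₀) ⊕ Θx ⊕ Θy) (jmp (jmp t' (ren suc u)) u) τ
                  (size D₀ + sizeₘ Dsx + weight (a ∷ A ++ G) + sizeₘ Dsy + weight (b ∷ B))
typing-c {Γ₀ = Γ₀} {Θx = Θx} {Θy = Θy} {b = b} {B = B} {G = G} D₀ ea eb Dsx Dsy with ren-typingₘ suc Dsx
... | typingₘ {Θx'} Dsx' e s =
  typing (jmp (jmp D₀ Dsx' (⊆ₘ-trans (↭⇒⊆ₘ (↭-reflexive ea)) (G , ↭-refl))) Dsy (↭⇒⊆ₘ outer-zero))
         (λ y → ++⁺ʳ (Θy y) (++⁺ˡ (Γ₀ (suc (suc y))) (↭-trans (e (suc y)) (renCx-suc Θx y))))
         (cong (λ z → size D₀ + z + _ + sizeₘ Dsy + _) s)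
  where
  outer-zero : Γ₀ (suc zero) ++ Θx' zero ↭ b ∷ B
  outer-zero = ↭-trans (++⁺ˡ (Γ₀ (suc zero)) (↭-trans (e zero) (↭-reflexive (renCx-suc-zero id Θx))))
                       (↭-trans (++-identityʳ _) (↭-reflexive eb))

reduct-c : (t' : Tm (suc (suc n))) → occ t' zero ≥ 1 → occ t' (suc zero) ≥ 1 →
           (D : Γ ⊢ jmp (ren merge t') u ∶ τ) → Reduct D (jmp (jmp t' (ren suc u)) u)
reduct-c t' o₀ o₁ (jmp {Γ = Γ} {Δ = Δ} {σ = σ} {M = M} Dt Ds (G , p)) with unren-typing merge t' Dt
... | Γ₀ , D₀ , e , s with nonempty (≤-trans o₀ (occ≤ D₀ zero)) | nonempty (≤-trans o₁ (occ≤ D₀ (suc zero)))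
... | a , A , ea | b , B , eb
  with ↭-regroup {X = a ∷ A} {Y = b ∷ B} p
         (↭-trans (e zero) (↭-trans (renCx-merge-zero Γ₀) (↭-reflexive (cong₂ _++_ ea eb))))
... | regrouped with splitₘ Ds regrouped
... | split {Θx} {Θy} Dsx Dsy e' s' with typing-c D₀ ea eb Dsx Dsy
... | typing Q e'' s'' = reduct Q (≈⇒⊑ (≈-trans e'' ctx≈)) size<
  where
  ctx≈ : tl (tl Γ₀) ⊕ Θx ⊕ Θy ≈ tl Γ ⊕ Δ
  ctx≈ y = ↭-trans (++⁺ʳ (Θy y) (++⁺ʳ (Θx y) (↭-sym (↭-trans (e (suc y)) (renCx-merge-suc Γ₀ y)))))
                   (↭-trans (++-assoc (Γ (suc y)) (Θx y) (Θy y)) (++⁺ˡ (Γ (suc y)) (↭-sym (e' y))))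
  open ≤-Reasoning
  size< : size Q < size Dt + sizeₘ Ds + weight (σ ∷ M)
  size< = begin-strict
    size Q
      ≡⟨ s'' ⟩
    size D₀ + sizeₘ Dsx + weight (a ∷ A ++ G) + sizeₘ Dsy + weight (b ∷ B)
      <⟨ duplication-size (size D₀) (sizeₘ Dsx) (sizeₘ Dsy) _ _ _ (weight-++-< a b (A ++ G) B) ⟩
    size D₀ + (sizeₘ Dsx + sizeₘ Dsy) + weight ((a ∷ A ++ G) ++ b ∷ B)
      ≡⟨ cong₂ _+_ (cong₂ _+_ s s') (sym (weight-↭ regrouped)) ⟩
    size Dt + sizeₘ Ds + weight (σ ∷ M)
      ∎

reduct-root : {t t' : Tm n} (D : Γ ⊢ t ∶ τ) → t ↦j t' → Reduct D t'
reduct-root D (dB L t u)             = reduct-dB L t u D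
reduct-root D (w _ t' _ _ refl)      = reduct-w t' D
reduct-root D (d t _ _)              = reduct-d t D
reduct-root D (c _ t' _ _ refl o₀ o₁) = reduct-c t' o₀ o₁ D

subject-reduction   : {t t' : Tm n} (D : Γ ⊢ t ∶ τ) → t →λj t' → Reduct D t'
subject-reductionₘ  : {t t' : Tm n} (Ds : Γ ⊢ t ∶ₘ M) → t →λj t' →
                      Σ[ Γ' ∈ Cx n ] Σ[ Ds' ∈ Γ' ⊢ t' ∶ₘ M ] Γ' ⊑ Γ × sizeₘ Ds' ≤ sizeₘ Ds
subject-reductionₘ⁺ : {t t' : Tm n} (Ds : Γ ⊢ t ∶ₘ σ ∷ M) → t →λj t' →
                      Σ[ Γ' ∈ Cx n ] Σ[ Ds' ∈ Γ' ⊢ t' ∶ₘ σ ∷ M ] Γ' ⊑ Γ × sizeₘ Ds' < sizeₘ Ds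

subject-reduction D (root r) = reduct-root D r
subject-reduction (lam D bc) (lam st) with subject-reduction D st
... | reduct D' le lt = reduct (lam D' (⊆ₘ-trans (le zero) bc)) (le ∘ suc) lt
subject-reduction (app {Δ = Δ} D Ds) (appl st) with subject-reduction D st
... | reduct D' le lt = reduct (app D' Ds) (⊕⁺-⊑ le (⊑-refl Δ)) (+-monoˡ-< _ (+-monoˡ-< (sizeₘ Ds) lt))
subject-reduction (app {Γ = Γ} D Ds) (appr st) with subject-reductionₘ⁺ Ds st
... | _ , Ds' , le , lt = reduct (app D Ds') (⊕⁺-⊑ (⊑-refl Γ) le) (+-monoˡ-< _ (+-monoʳ-< (size D) lt))
subject-reduction (jmp {Δ = Δ} D Ds bc) (jmpl st) with subject-reduction D st
... | reduct D' le lt =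
  reduct (jmp D' Ds (⊆ₘ-trans (le zero) bc)) (⊕⁺-⊑ (le ∘ suc) (⊑-refl Δ)) (+-monoˡ-< _ (+-monoˡ-< (sizeₘ Ds) lt))
subject-reduction (jmp {Γ = Γ} D Ds bc) (jmpr st) with subject-reductionₘ⁺ Ds st
... | _ , Ds' , le , lt = reduct (jmp D Ds' bc) (⊕⁺-⊑ (⊑-refl (tl Γ)) le) (+-monoˡ-< _ (+-monoʳ-< (size D) lt))

subject-reductionₘ [] st = ∅ , [] , ⊑-refl ∅ , ≤-refl
subject-reductionₘ (D ∷ Ds) st with subject-reduction D st | subject-reductionₘ Ds st
... | reduct D' le lt | _ , Ds' , le' , lt' = _ , D' ∷ Ds' , ⊕⁺-⊑ le le' , +-mono-≤ (<⇒≤ lt) lt'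

subject-reductionₘ⁺ (D ∷ Ds) st with subject-reduction D st | subject-reductionₘ Ds st
... | reduct D' le lt | _ , Ds' , le' , lt' = _ , D' ∷ Ds' , ⊕⁺-⊑ le le' , +-mono-<-≤ lt lt'

typable⇒SN : Γ ⊢ t ∶ τ → SN _→λj_ t
typable⇒SN D = go D (<-wellFounded (size D))
  where
  go : {Γ : Cx n} {t : Tm n} (D : Γ ⊢ t ∶ τ) → Acc _<_ (size D) → SN _→λj_ t
  go D (acc smaller) =
    acc λ st → let r = subject-reduction D st in go (Reduct.der r) (smaller (Reduct.smaller r))

-- Completeness: β-strongly normalising pure terms are typable

pure-ren : (ρ : Fin n → Fin m) → Pure t → Pure (ren ρ t)
pure-ren ρ (var x)   = var (ρ x)
pure-ren ρ (lam p)   = lam (pure-ren (lift ρ) p)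
pure-ren ρ (app p q) = app (pure-ren ρ p) (pure-ren ρ q)

pure-subst : (θ : Fin n → Tm m) → (∀ x → Pure (θ x)) → Pure t → Pure (subst θ t)
pure-subst θ h (var x)   = h x
pure-subst θ h (lam p)   = lam (pure-subst (liftS θ) lifted p)
  where
  lifted : ∀ x → Pure (liftS θ x)
  lifted zero    = var zero
  lifted (suc x) = pure-ren suc (h x)
pure-subst θ h (app p q) = app (pure-subst θ h p) (pure-subst θ h q)

pure-sub0 : Pure u → ∀ x → Pure (sub0 u x)
pure-sub0 p zero    = p
pure-sub0 p (suc x) = var x

AnyTm : Set
AnyTm = Σ ℕ Tm

infix 4 _≺_ _⊴_
data _≺_ : AnyTm → AnyTm → Set where
  β-step   : {t t' : Tm n} → t →β t' → (n , t') ≺ (n , t)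
  lam-body : {t : Tm (suc n)} → (suc n , t) ≺ (n , lam t)
  app-fun  : {t u : Tm n} → (n , t) ≺ (n , app t u)
  app-arg  : {t u : Tm n} → (n , u) ≺ (n , app t u)

data _⊴_ : AnyTm → AnyTm → Set where
  here      : {p : AnyTm} → p ⊴ p
  under-lam : {p : AnyTm} {t : Tm (suc n)} → p ⊴ (suc n , t) → p ⊴ (n , lam t)
  in-fun    : {p : AnyTm} {t u : Tm n} → p ⊴ (n , t) → p ⊴ (n , app t u)
  in-arg    : {p : AnyTm} {t u : Tm n} → p ⊴ (n , u) → p ⊴ (n , app t u)

⊴-trans : {p q r : AnyTm} → p ⊴ q → q ⊴ r → p ⊴ r
⊴-trans p⊴q here          = p⊴q
⊴-trans p⊴q (under-lam h) = under-lam (⊴-trans p⊴q h)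
⊴-trans p⊴q (in-fun h)    = in-fun (⊴-trans p⊴q h)
⊴-trans p⊴q (in-arg h)    = in-arg (⊴-trans p⊴q h)

⊴-β-step : {s s' : Tm m} {t : Tm n} → (m , s) ⊴ (n , t) → s →β s' →
           Σ[ t' ∈ Tm n ] t →β t' × (m , s') ⊴ (n , t')
⊴-β-step here st = _ , st , here
⊴-β-step (under-lam h) st with ⊴-β-step h st
... | t' , tt , h' = lam t' , lam tt , under-lam h'
⊴-β-step (in-fun {u = u} h) st with ⊴-β-step h st
... | t' , tt , h' = app t' u , appl tt , in-fun h'
⊴-β-step (in-arg {t = t} h) st with ⊴-β-step h st
... | t' , tt , h' = app t t' , appr tt , in-arg h'

-- Induction on β-SN of t, since a β-step of a subterm s ⊴ t is a β-step of t.
SN⇒≺-acc : (t : Tm n) → SN _→β_ t → (s : Tm m) → (m , s) ⊴ (n , t) → Acc _≺_ (m , s)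
SN⇒≺-acc t sn s h = acc (below t sn s h)
  where
  below : ∀ {n m} (t : Tm n) → SN _→β_ t → (s : Tm m) → (m , s) ⊴ (n , t) →
          {r : AnyTm} → r ≺ (m , s) → Acc _≺_ r
  below t (acc rs) s h (β-step st) with ⊴-β-step h st
  ... | t' , tt , h' = SN⇒≺-acc t' (rs tt) _ h'
  below t sn (lam s) h lam-body    = SN⇒≺-acc t sn s (⊴-trans (under-lam here) h)
  below t sn (app s _) h app-fun   = SN⇒≺-acc t sn s (⊴-trans (in-fun here) h)
  below t sn (app _ u) h app-arg   = SN⇒≺-acc t sn u (⊴-trans (in-arg here) h)

_≺⁺_ : AnyTm → AnyTm → Set
_≺⁺_ = TransClosure _≺_

data HeadCtx (n : ℕ) : Set where
  hole : HeadCtx n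
  _·_  : HeadCtx n → Tm n → HeadCtx n

infixl 30 _[_]ₕ
_[_]ₕ : HeadCtx n → Tm n → Tm n
hole    [ t ]ₕ = t
(C · v) [ t ]ₕ = app (C [ t ]ₕ) v

data Neutral {n : ℕ} : Tm n → Set where
  var : (x : Fin n) → Neutral (var x)
  app : {t u : Tm n} → Neutral t → Neutral (app t u)

data HeadForm {n : ℕ} : Tm n → Set where
  neutral     : {t : Tm n} → Neutral t → HeadForm t
  abstraction : (s : Tm (suc n)) → HeadForm (lam s)
  head-redex  : (C : HeadCtx n) (s : Tm (suc n)) (u : Tm n) → HeadForm (C [ app (lam s) u ]ₕ)

head-form : (t : Tm n) → Pure t → HeadForm t
head-form (var x) _ = neutral (var x)
head-form (lam s) _ = abstraction s
head-form (app t u) (app p _) with head-form t p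
... | neutral ne         = neutral (app ne)
... | abstraction s      = head-redex hole s u
... | head-redex C s u'  = head-redex (C · u) s u'

pure-head-redex : (C : HeadCtx n) {s : Tm (suc n)} → Pure (C [ app (lam s) u ]ₕ) →
                  Pure s × Pure u × ({t : Tm n} → Pure t → Pure (C [ t ]ₕ))
pure-head-redex hole (app (lam ps) pu) = ps , pu , id
pure-head-redex (C · v) (app p pv) with pure-head-redex C p
... | ps , pu , fill = ps , pu , λ q → app (fill q) pv

[]ₕ-β-step : (C : HeadCtx n) {t t' : Tm n} → t →β t' → C [ t ]ₕ →β C [ t' ]ₕ
[]ₕ-β-step hole    st = st
[]ₕ-β-step (C · v) st = appl ([]ₕ-β-step C st)

head-arg≺⁺ : (C : HeadCtx n) (s : Tm (suc n)) (u : Tm n) → (n , u) ≺⁺ (n , C [ app (lam s) u ]ₕ)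
head-arg≺⁺ hole    s u = [ app-arg ]⁺
head-arg≺⁺ (C · v) s u = head-arg≺⁺ C s u ∷ʳ app-fun

Typable : Tm n → Set
Typable {n = n} t = Σ[ τ ∈ Ty ] Σ[ Γ ∈ Cx n ] Γ ⊢ t ∶ τ

-- Subject expansion for head redexes.  The argument u must be typed separately:
-- if s erases its variable, u receives no type from s ⟨0≔ u ⟩.
head-expansion : (C : HeadCtx n) {s : Tm (suc n)} → Pure s → {Γ' Δ : Cx n} →
                 Γ' ⊢ C [ s ⟨0≔ u ⟩ ]ₕ ∶ τ → Δ ⊢ u ∶ σ → Σ[ Γ ∈ Cx n ] Γ ⊢ C [ app (lam s) u ]ₕ ∶ τ
head-expansion {u = u} hole ps D Du with anti-subst (sub0 u) ps D
... | Γ₀ , D₀ , S , _ = _ , app (lam D₀ (⊆ₘ-∷ _ (Γ₀ zero))) (Du ∷ ders S zero)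
head-expansion (C · v) ps (app D Ds) Du with head-expansion C ps D Du
... | _ , D' = _ , app D' Ds

typable         : (t : Tm n) → Pure t → Acc _≺⁺_ (n , t) → Typable t
typable-neutral : {t : Tm n} → Neutral t → Pure t → Acc _≺⁺_ (n , t) → (τ : Ty) → Σ[ Γ ∈ Cx n ] Γ ⊢ t ∶ τ
typable t p a = by-head-form t p a (head-form t p)
  where
  by-head-form : {n : ℕ} (t : Tm n) → Pure t → Acc _≺⁺_ (n , t) → HeadForm t → Typable t
  by-head-form t p a (neutral ne) = o , typable-neutral ne p a o
  by-head-form (lam s) (lam p) (acc smaller) (abstraction s) with typable s p (smaller [ lam-body ]⁺)
  ... | τ , Γ , D = Γ zero ⇒ τ , tl Γ , lam D (⊆ₘ-refl (Γ zero))
  by-head-form _ p (acc smaller) (head-redex C s u) with pure-head-redex C p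
  ... | ps , pu , fill
    with typable (C [ s ⟨0≔ u ⟩ ]ₕ) (fill (pure-subst (sub0 u) (pure-sub0 pu) ps))
                 (smaller [ β-step ([]ₕ-β-step C (root (beta s u))) ]⁺)
       | typable u pu (smaller (head-arg≺⁺ C s u))
  ... | τ , _ , D | _ , _ , Du = τ , head-expansion C ps D Du
typable-neutral (var x) _ _ τ = single x τ , var x τ
typable-neutral (app ne) (app p q) (acc smaller) τ with typable _ q (smaller [ app-arg ]⁺)
... | σ , Δ , Du with typable-neutral ne p (smaller [ app-fun ]⁺) ([ σ ] ⇒ τ)
... | Γ , D = Γ ⊕ (Δ ⊕ ∅) , app D (Du ∷ [])

β-SN⇒typable : Pure t → SN _→β_ t → Typable t
β-SN⇒typable {t = t} p sn = typable t p (accessible _≺_ (SN⇒≺-acc t sn t here))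

corollary3p5 : (n : ℕ) (t : Tm n) → Pure t → SN _→β_ t → SN _→λj_ t
corollary3p5 n t pure sn with β-SN⇒typable pure sn
... | _ , _ , D = typable⇒SN D
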